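{- Let $c,h,d\in\omega^\omega$ with $c>h$, $h(i)\ge1$ for all but finitely many $i$, $d\ge2$, and $\limsup_{n\to\infty}\frac{1}{d(n)}\log_{d(n)}h(n)=\infty$. Fix $n,m<\omega$ and $1\le k<\omega$ with $m/k\le d(n)$. Whenever $M\subseteq[c(n)]^{\le h(n)}$ is non-empty and $f:M\to m$, there is a non-empty $M^*\subseteq M$ such that $|f[M^*]|\le k$ and $\|M^*\|^d_{c,h,n}\ge\|M\|^d_{c,h,n}-\frac{1}{d(n)}$.
   Context: Natural numbers are identified with $\{0,\dots,n-1\}$. For non-empty $M\subseteq[c(n)]^{\le h(n)}$, $\|M\|_{c,h,n}:=\max\{k'\mid\forall Y\in[c(n)]^{\le k'}\ \exists X\in M: Y\subseteq X\}$ and $\|M\|^d_{c,h,n}:=\frac{1}{d(n)}\log_{d(n)}(\|M\|_{c,h,n}+1)$. -}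

module Defs where

open import Data.Nat using (ℕ; suc; _≤_)
open import Data.Fin using (Fin)
open import Data.Fin.Subset using (Subset; _⊆_; ∣_∣; ⁅_⁆; _∪_; ⊥)
open import Data.List using (List; foldr)
open import Data.List.Relation.Unary.Any using (Any)
open import Data.Product using (_×_)

-- A family M ⊆ [N]^{≤h} is a (non-empty) finite list of subsets of N = {0,…,N-1}.

Covers : {N : ℕ} → List (Subset N) → ℕ → Set
Covers {N} M k′ = (Y : Subset N) → ∣ Y ∣ ≤ k′ → Any (λ X → Y ⊆ X) M

NormIs : {N : ℕ} → List (Subset N) → ℕ → Set
NormIs M k = Covers M k × ((k′ : ℕ) → Covers M k′ → k′ ≤ k)

image : {N m : ℕ} → (Subset N → Fin m) → List (Subset N) → Subset m
image f = foldr (λ X acc → ⁅ f X ⁆ ∪ acc) ⊥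

{-# OPTIONS --safe #-}
-- Cut the colours 0, …, m-1 into d(n) consecutive windows of length k; the colour classes
-- M_j = {X ∈ M | ⌊f X / k⌋ = j} each use at most k colours.  If no class covered all
-- t-sets, one uncovered t-set Y_j per class would give a set ⋃_j Y_j of size ≤ d(n)·t that
-- no X ∈ M contains.  Hence some class covers ⌊‖M‖/d(n)⌋, so its norm b satisfies
-- ‖M‖ + 1 ≤ d(n)(b + 1), which is the claimed inequality after taking log_{d(n)}.
module Submission where

open import Defs
open import Data.Nat using (ℕ; zero; suc; _≤_; _<_; _+_; _*_; _^_; _≟_; NonZero; >-nonZero; z≤n; z<s; s≤s; s≤s⁻¹)
open import Data.Nat.Properties
open import Data.Nat.DivMod using (_/_; m≡m%n+[m/n]*n; m%n<n; m/n*n≤m; m<n*o⇒m/o<n)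
open import Data.Fin using (Fin; toℕ; fromℕ<)
open import Data.Fin.Properties using (toℕ<n; toℕ-fromℕ<; any?)
open import Data.Fin.Subset using (Subset; _⊆_; ∣_∣; _∪_; ⋃; ⊥; ⊤; inside; outside)
  renaming (_∈_ to _∈ₛ_)
open import Data.Fin.Subset.Properties
  using (anySubset?; _⊆?_; ∣p∣≤∣x∷p∣; p⊆q⇒∣p∣≤∣q∣; p⊆p∪q; q⊆p∪q; ⊆-trans; ∣⊥∣≡0; ∣⊤∣≡n; ∉⊥; x∈p∪q⁻; x∈⁅y⁆⇒x≡y)
open import Data.Vec.Base using ([]; _∷_; here; there)
open import Data.List using (List; []; _∷_; length; tabulate; filter)
open import Data.List.Properties using (length-tabulate)
open import Data.List.Relation.Unary.Any using (Any; here; there)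
import Data.List.Relation.Unary.Any as Any
open import Data.List.Relation.Unary.All as All using (All; []; _∷_)
open import Data.List.Relation.Unary.All.Properties using (tabulate⁺)
open import Data.List.Membership.Propositional using (_∈_; find; lose)
open import Data.List.Membership.Propositional.Properties using (∈-filter⁺; ∈-filter⁻; ∈-tabulate⁺)
open import Data.Product as Product using (_×_; Σ; ∃; _,_; proj₁; proj₂)
open import Data.Sum using (inj₁; inj₂)
open import Data.Empty using (⊥-elim)
open import Relation.Nullary using (¬_; yes; no; ¬?; _×-dec_; contradiction)
open import Relation.Nullary.Decidable using (decidable-stable)
open import Relation.Unary using (Decidable)
open import Function using (_∘_)
open import Relation.Binary.PropositionalEquality using (_≡_; _≢_; refl; sym; subst)

m<[1+m/n]*n : ∀ m n .{{_ : NonZero n}} → m < suc (m / n) * n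
m<[1+m/n]*n m n = subst (_< n + m / n * n) (sym (m≡m%n+[m/n]*n m n)) (+-monoˡ-< (m / n * n) (m%n<n m n))

crossing : ∀ {P : ℕ → Set} → Decidable P → P 0 → ∀ {n} → ¬ P n → ∃ λ s → P s × ¬ P (suc s)
crossing P? p0 {zero}  ¬p0 = contradiction p0 ¬p0
crossing P? p0 {suc n} ¬p1+n with P? n
... | yes pn  = n , pn , ¬p1+n
... | no  ¬pn = crossing P? p0 ¬pn

x∈p⇒0<∣p∣ : ∀ {n} {p : Subset n} {i} → i ∈ₛ p → 0 < ∣ p ∣
x∈p⇒0<∣p∣                        here        = z<s
x∈p⇒0<∣p∣ {p = inside  ∷ _} (there _)   = z<s
x∈p⇒0<∣p∣ {p = outside ∷ _} (there i∈p) = x∈p⇒0<∣p∣ i∈p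

∣p∪q∣≤∣p∣+∣q∣ : ∀ {n} (p q : Subset n) → ∣ p ∪ q ∣ ≤ ∣ p ∣ + ∣ q ∣
∣p∪q∣≤∣p∣+∣q∣ []            []            = z≤n
∣p∪q∣≤∣p∣+∣q∣ (inside  ∷ p) (x       ∷ q) = s≤s (≤-trans (∣p∪q∣≤∣p∣+∣q∣ p q) (+-monoʳ-≤ ∣ p ∣ (∣p∣≤∣x∷p∣ x q)))
∣p∪q∣≤∣p∣+∣q∣ (outside ∷ p) (inside  ∷ q) = subst (suc ∣ p ∪ q ∣ ≤_) (sym (+-suc ∣ p ∣ ∣ q ∣)) (s≤s (∣p∪q∣≤∣p∣+∣q∣ p q))
∣p∪q∣≤∣p∣+∣q∣ (outside ∷ p) (outside ∷ q) = ∣p∪q∣≤∣p∣+∣q∣ p q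

∣⋃ps∣≤length*t : ∀ {n t} {ps : List (Subset n)} → All (λ p → ∣ p ∣ ≤ t) ps → ∣ ⋃ ps ∣ ≤ length ps * t
∣⋃ps∣≤length*t {n} [] = ≤-reflexive (∣⊥∣≡0 n)
∣⋃ps∣≤length*t {ps = p ∷ ps} (∣p∣≤t ∷ ∣ps∣≤t) =
  ≤-trans (∣p∪q∣≤∣p∣+∣q∣ p (⋃ ps)) (+-mono-≤ ∣p∣≤t (∣⋃ps∣≤length*t ∣ps∣≤t))

p∈ps⇒p⊆⋃ps : ∀ {n} {p : Subset n} {ps} → p ∈ ps → p ⊆ ⋃ ps
p∈ps⇒p⊆⋃ps {ps = p ∷ ps} (here refl) = p⊆p∪q (⋃ ps)
p∈ps⇒p⊆⋃ps {ps = q ∷ ps} (there p∈ps) = ⊆-trans (p∈ps⇒p⊆⋃ps p∈ps) (q⊆p∪q q (⋃ ps))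

in-window⇒∣p∣≤w : ∀ {n} (p : Subset n) lo w → (∀ {i} → i ∈ₛ p → lo ≤ toℕ i × toℕ i < lo + w) → ∣ p ∣ ≤ w
in-window⇒∣p∣≤w []            _        _       _   = z≤n
in-window⇒∣p∣≤w (inside  ∷ p) (suc lo) w       win with () ← proj₁ (win here)
in-window⇒∣p∣≤w (outside ∷ p) (suc lo) w       win =
  in-window⇒∣p∣≤w p lo w (λ i∈p → Product.map s≤s⁻¹ s≤s⁻¹ (win (there i∈p)))
in-window⇒∣p∣≤w (inside  ∷ p) zero     zero    win with () ← proj₂ (win here)
in-window⇒∣p∣≤w (outside ∷ p) zero     zero    win =
  in-window⇒∣p∣≤w p zero zero (λ i∈p → contradiction (proj₂ (win (there i∈p))) λ ())
in-window⇒∣p∣≤w (x       ∷ p) zero     (suc w) win = ≤-trans (∣x∷p∣≤1+∣p∣ x) (s≤s ∣p∣≤w)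
  where
    ∣p∣≤w : ∣ p ∣ ≤ w
    ∣p∣≤w = in-window⇒∣p∣≤w p zero w (λ i∈p → z≤n , s≤s⁻¹ (proj₂ (win (there i∈p))))
    ∣x∷p∣≤1+∣p∣ : ∀ x → ∣ x ∷ p ∣ ≤ suc ∣ p ∣
    ∣x∷p∣≤1+∣p∣ inside  = ≤-refl
    ∣x∷p∣≤1+∣p∣ outside = n≤1+n ∣ p ∣

same-quotient⇒∣p∣≤k : ∀ {n} (p : Subset n) k .{{_ : NonZero k}} q →
                      (∀ {i} → i ∈ₛ p → toℕ i / k ≡ q) → ∣ p ∣ ≤ k
same-quotient⇒∣p∣≤k p k q quot = in-window⇒∣p∣≤w p (q * k) k window
  where
    window : ∀ {i} → i ∈ₛ p → q * k ≤ toℕ i × toℕ i < q * k + k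
    window {i} i∈p rewrite sym (quot i∈p) =
      m/n*n≤m (toℕ i) k , subst (toℕ i <_) (+-comm k _) (m<[1+m/n]*n (toℕ i) k)

∈-image⁻ : ∀ {N m} (f : Subset N → Fin m) (L : List (Subset N)) {i} →
           i ∈ₛ image f L → ∃ λ X → X ∈ L × f X ≡ i
∈-image⁻ f []      i∈ = ⊥-elim (∉⊥ i∈)
∈-image⁻ f (X ∷ L) i∈ with x∈p∪q⁻ _ (image f L) i∈
... | inj₁ i∈⁅fX⁆ = X , here refl , sym (x∈⁅y⁆⇒x≡y (f X) i∈⁅fX⁆)
... | inj₂ i∈fL   = Product.map₂ (Product.map₁ there) (∈-image⁻ f L i∈fL)

module _ {N : ℕ} where

  Uncovered : List (Subset N) → ℕ → Set
  Uncovered L t = ∃ λ Y → ∣ Y ∣ ≤ t × ¬ Any (Y ⊆_) L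

  uncovered? : ∀ L → Decidable (Uncovered L)
  uncovered? L t = anySubset? (λ Y → (∣ Y ∣ ≤? t) ×-dec ¬? (Any.any? (Y ⊆?_) L))

  ¬uncovered⇒covers : ∀ {L t} → ¬ Uncovered L t → Covers L t
  ¬uncovered⇒covers {L} ¬unc Y ∣Y∣≤t =
    decidable-stable (Any.any? (Y ⊆?_) L) (λ ¬any → ¬unc (Y , ∣Y∣≤t , ¬any))

  ¬covers⇒uncovered : ∀ {L t} → ¬ Covers L t → Uncovered L t
  ¬covers⇒uncovered {L} {t} ¬cov with uncovered? L t
  ... | yes unc  = unc
  ... | no  ¬unc = contradiction (¬uncovered⇒covers ¬unc) ¬cov

  covers? : ∀ L → Decidable (Covers L)
  covers? L t with uncovered? L t
  ... | yes (Y , ∣Y∣≤t , ¬any) = no (λ cov → ¬any (cov Y ∣Y∣≤t))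
  ... | no  ¬unc               = yes (¬uncovered⇒covers ¬unc)

  covers-≤ : ∀ {L : List (Subset N)} {a b} → b ≤ a → Covers L a → Covers L b
  covers-≤ b≤a cov Y ∣Y∣≤b = cov Y (≤-trans ∣Y∣≤b b≤a)

  covers-0 : ∀ {L : List (Subset N)} → L ≢ [] → Covers L 0
  covers-0 {[]}    L≢[] = contradiction refl L≢[]
  covers-0 {X ∷ L} L≢[] Y ∣Y∣≤0 = here λ i∈Y → contradiction ∣Y∣≤0 (<⇒≱ (x∈p⇒0<∣p∣ i∈Y))

  covers-0⁻ : ∀ {L : List (Subset N)} → Covers L 0 → L ≢ []
  covers-0⁻ cov refl with () ← cov ⊥ (≤-reflexive (∣⊥∣≡0 N))

  ¬covers-size : ∀ {L : List (Subset N)} → All (λ X → ∣ X ∣ < N) L → ¬ Covers L N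
  ¬covers-size small cov with find (cov ⊤ (≤-reflexive (∣⊤∣≡n N)))
  ... | X , X∈L , ⊤⊆X = <⇒≱ (All.lookup small X∈L) (subst (_≤ ∣ X ∣) (∣⊤∣≡n N) (p⊆q⇒∣p∣≤∣q∣ ⊤⊆X))

  norm-exists : ∀ {L : List (Subset N)} {n} → Covers L 0 → ¬ Covers L n → ∃ (NormIs L)
  norm-exists {L} cov0 ¬covn with crossing (covers? L) cov0 ¬covn
  ... | s , covs , ¬cov1+s = s , covs , λ t covt → ≮⇒≥ (λ s<t → ¬cov1+s (covers-≤ s<t covt))

  norm-unique : ∀ {L : List (Subset N)} {a b} → NormIs L a → NormIs L b → a ≡ b
  norm-unique (cova , maxa) (covb , maxb) = ≤-antisym (maxb _ cova) (maxa _ covb)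

  pigeonhole-covers : ∀ {D t} {M : List (Subset N)} (C : Fin D → List (Subset N)) →
                      (∀ {X} → X ∈ M → ∃ λ j → X ∈ C j) → Covers M (D * t) → ∃ λ j → Covers (C j) t
  pigeonhole-covers {D} {t} {M} C classify cov with any? (λ j → covers? (C j) t)
  ... | yes some = some
  ... | no  none = contradiction (cov (⋃ (tabulate Y)) ∣⋃Y∣≤D*t) ⋃Y-uncovered
    where
      uncovered : ∀ j → Uncovered (C j) t
      uncovered j = ¬covers⇒uncovered (λ covj → none (j , covj))
      Y : Fin D → Subset N
      Y = proj₁ ∘ uncovered
      ∣⋃Y∣≤D*t : ∣ ⋃ (tabulate Y) ∣ ≤ D * t
      ∣⋃Y∣≤D*t = subst (λ l → ∣ ⋃ (tabulate Y) ∣ ≤ l * t) (length-tabulate Y)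
                   (∣⋃ps∣≤length*t (tabulate⁺ (proj₁ ∘ proj₂ ∘ uncovered)))
      ⋃Y-uncovered : ¬ Any (⋃ (tabulate Y) ⊆_) M
      ⋃Y-uncovered ⋃Y⊆some with find ⋃Y⊆some
      ... | X , X∈M , ⋃Y⊆X with classify X∈M
      ...   | j , X∈Cj = proj₂ (proj₂ (uncovered j)) (lose X∈Cj (⊆-trans (p∈ps⇒p⊆⋃ps (∈-tabulate⁺ j)) ⋃Y⊆X))

module ColourClasses {N m : ℕ} (f : Subset N → Fin m) (k D : ℕ) .{{_ : NonZero k}} .{{_ : NonZero D}}
                     (m≤k*D : m ≤ k * D) (M : List (Subset N)) where

  window : Subset N → ℕ
  window X = toℕ (f X) / k

  window<D : ∀ X → window X < D
  window<D X = m<n*o⇒m/o<n (<-≤-trans (toℕ<n (f X)) (subst (m ≤_) (*-comm k D) m≤k*D))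

  colourClass : Fin D → List (Subset N)
  colourClass j = filter (λ X → window X ≟ toℕ j) M

  ∈-colourClass : ∀ {X} → X ∈ M → ∃ λ j → X ∈ colourClass j
  ∈-colourClass {X} X∈M = fromℕ< (window<D X) , ∈-filter⁺ _ X∈M (sym (toℕ-fromℕ< (window<D X)))

  colourClass⊆M : ∀ j → All (_∈ M) (colourClass j)
  colourClass⊆M j = All.tabulate (proj₁ ∘ ∈-filter⁻ _)

  ∣image-colourClass∣≤k : ∀ j → ∣ image f (colourClass j) ∣ ≤ k
  ∣image-colourClass∣≤k j = same-quotient⇒∣p∣≤k _ k (toℕ j) λ i∈image →
    let X , X∈class , fX≡i = ∈-image⁻ f (colourClass j) i∈image
    in subst (λ c → toℕ c / k ≡ toℕ j) fX≡i (proj₂ (∈-filter⁻ _ {xs = M} X∈class))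

  refinement : M ≢ [] → All (λ X → ∣ X ∣ < N) M →
               Σ (List (Subset N)) λ M* → M* ≢ [] × All (_∈ M) M* × ∣ image f M* ∣ ≤ k
                 × Σ ℕ λ b → NormIs M* b × ((a : ℕ) → NormIs M a → suc a ≤ D * suc b)
  refinement M≢[] small with norm-exists (covers-0 M≢[]) (¬covers-size small)
  ... | a₀ , ‖M‖≡a₀ with pigeonhole-covers colourClass ∈-colourClass (covers-≤ (D*[a₀/D]≤a₀) (proj₁ ‖M‖≡a₀))
    where D*[a₀/D]≤a₀ : D * (a₀ / D) ≤ a₀
          D*[a₀/D]≤a₀ = subst (_≤ a₀) (*-comm (a₀ / D) D) (m/n*n≤m a₀ D)
  ... | j , class-covers-t
    with norm-exists (covers-≤ z≤n class-covers-t) (¬covers-size (All.map (All.lookup small) (colourClass⊆M j)))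
  ... | b , ‖class‖≡b =
    colourClass j , covers-0⁻ (covers-≤ z≤n class-covers-t) , colourClass⊆M j , ∣image-colourClass∣≤k j ,
    b , ‖class‖≡b , bound
    where
      bound : ∀ a → NormIs M a → suc a ≤ D * suc b
      bound a ‖M‖≡a rewrite norm-unique ‖M‖≡a ‖M‖≡a₀ = begin-strict
        a₀               <⟨ m<[1+m/n]*n a₀ D ⟩
        suc (a₀ / D) * D ≤⟨ *-monoˡ-≤ D (s≤s (proj₂ ‖class‖≡b (a₀ / D) class-covers-t)) ⟩
        suc b * D        ≡⟨ *-comm (suc b) D ⟩
        D * suc b        ∎
        where open ≤-Reasoning

corollary3p11 : (c h d : ℕ → ℕ)
    → ((i : ℕ) → h i < c i)
    → Σ ℕ (λ N₀ → (i : ℕ) → N₀ ≤ i → 1 ≤ h i)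
    → ((i : ℕ) → 2 ≤ d i)
    → ((K N₀ : ℕ) → Σ ℕ (λ i → N₀ ≤ i × d i ^ (K * d i) ≤ h i))
    → (n m k : ℕ) → 1 ≤ k → m ≤ k * d n
    → (M : List (Subset (c n))) → M ≢ []
    → All (λ X → ∣ X ∣ ≤ h n) M
    → (f : Subset (c n) → Fin m)
    → Σ (List (Subset (c n))) (λ M* →
        M* ≢ [] × All (λ X → X ∈ M) M*
        × ∣ image f M* ∣ ≤ k
        × Σ ℕ (λ b → NormIs M* b
            × ((a : ℕ) → NormIs M a → suc a ≤ d n * suc b)))
corollary3p11 c h d h<c _ 2≤d _ n m k 1≤k m≤k*d M M≢[] ∣M∣≤h f =
  ColourClasses.refinement f k (d n) {{>-nonZero 1≤k}} {{>-nonZero (<-trans z<s (2≤d n))}} m≤k*d M M≢[]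
    (All.map (λ ∣X∣≤h → ≤-<-trans ∣X∣≤h (h<c n)) ∣M∣≤h)
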